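{- Let $N\geq3$ and let $\rho$ be the unique positive real root of $X^N-X^{N-1}-\cdots-X-1$. (1) Let $\mathcal T$ be the inflation–substitution tiling with prototiles $R_j$ of length $\rho^{1-j}$ ($1\leq j\leq N$), initial tile $[0,1]=R_1$ and substitution rules $\rho R_1=R_1|R_2|\cdots|R_N$, $\rho R_j=R_{j-1}$ for $2\leq j\leq N$. Then every $\rho$-integer is an endpoint of some tile of $\mathcal T$ (the tiling of $[0,\infty)$ whose endpoints are the $\rho$-integers is subordinate to $\mathcal T$). (2) Let $\widehat{\mathcal T}$ be the inflation–substitution tiling with prototiles $\widehat R_1,\dots,\widehat R_N$ of lengths $1$ and $\sum_{i=1}^{N-j+1}\rho^{ -i}$ for $2\leq j\leq N$ (i.e. $1,\ \frac1\rho+\cdots+\frac1{\rho^{N-1}},\ \dots,\ \frac1\rho$), initial tile $[0,1]=\widehat R_1$, and substitution rules $\rho\widehat R_j=\widehat R_1|\widehat R_{j+1}$ for $1\leq j\leq N-1$, $\rho\widehat R_N=\widehat R_1$. Then $\widehat{\mathcal T}$ is inflationary with multiplier $\rho$, and the set of its endpoints is exactly the set of $\rho$-integers.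
   Context: A non-negative real number is a $\rho$-integer if it equals $\sum_{i=0}^{n}c_i\rho^{n-i}$ for some $n\in\mathbb N_0$ and $c_i\in\{0,1\}$. Inflation–substitution tiling: given prototiles (intervals of given lengths) and for each prototile a finite word in the prototiles (the substitution rule, written $\rho R=\cdots$, whose lengths sum to $\rho$ times the length of $R$) such that the word for the initial prototile begins with that prototile, start with the one-letter word consisting of the initial prototile and repeatedly replace every letter by its word; each word is a prefix of the next, so they converge to an infinite word, and laying intervals of the corresponding lengths consecutively starting at $0$ gives a tiling of $[0,\infty)$, with endpoints the partial sums of lengths. A tiling $\mathcal T'$ is subordinate to $\mathcal T$ if every endpoint of $\mathcal T'$ is an endpoint of $\mathcal T$. A tiling with endpoints $0=y_0<y_1<\cdots$ is inflationary with multiplier $\rho$ if there is a rule assigning to each occurring tile length $\ell$ an ordered list of occurring lengths with sum $\rho\ell$ such that each $[\rho y_{i-1},\rho y_i]$ is exactly the union of consecutive tiles whose lengths in order form the list assigned to $y_i-y_{i-1}$. -}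

module Defs where

open import Level using (Level; _⊔_) renaming (suc to lsuc)
open import Algebra.Bundles using (CommutativeRing)
open import Relation.Binary.Core using (Rel)
open import Relation.Binary.Structures using (IsStrictTotalOrder)
open import Relation.Nullary using (¬_; yes; no)
open import Data.Nat as ℕ using (ℕ; zero; suc; _∸_; _<?_)
open import Data.Fin using (Fin; toℕ; fromℕ<; inject₁)
open import Data.Bool using (Bool; if_then_else_)
open import Data.List using (List; []; _∷_; [_]; map; foldr; concatMap; take; drop; length; lookup; upTo; allFin)
open import Data.List.Relation.Binary.Pointwise using (Pointwise)
open import Data.Product using (Σ; ∃; ∃-syntax; _×_)

-- Ordered fields (stdlib has none).  The real numbers are one; the
-- statement is proved uniformly for every ordered field containing a
-- positive root of X^N - X^(N-1) - ... - X - 1.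

record OrderedField (c ℓ₁ ℓ₂ : Level) : Set (lsuc (c ⊔ ℓ₁ ⊔ ℓ₂)) where
  field
    commutativeRing : CommutativeRing c ℓ₁
  open CommutativeRing commutativeRing public
  field
    _<_                : Rel Carrier ℓ₂
    isStrictTotalOrder : IsStrictTotalOrder _≈_ _<_
    0≉1                : ¬ (0# ≈ 1#)
    +-monoˡ-<          : ∀ z {x y} → x < y → (x + z) < (y + z)
    *-pos              : ∀ {x y} → 0# < x → 0# < y → 0# < (x * y)
    _⁻¹                : Carrier → Carrier
    ⁻¹-inverse         : ∀ x → ¬ (x ≈ 0#) → (x * (x ⁻¹)) ≈ 1#

module Tiling {c ℓ₁ ℓ₂ : Level} (F : OrderedField c ℓ₁ ℓ₂) where
  open OrderedField F

  pow : Carrier → ℕ → Carrier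
  pow x zero    = 1#
  pow x (suc n) = x * pow x n

  sumL : List Carrier → Carrier
  sumL = foldr _+_ 0#

  charPoly : ℕ → Carrier → Carrier
  charPoly N x = pow x N - sumL (map (pow x) (upTo N))

  IsρInteger : Carrier → Carrier → Set ℓ₁
  IsρInteger ρ x =
    ∃[ n ] Σ (Fin (suc n) → Bool) λ cs →
      (x ≈ sumL (map (λ (i : Fin (suc n)) → if cs i then pow ρ (n ∸ toℕ i) else 0#)
                     (allFin (suc n))))

  record Substitution (k : ℕ) : Set c where
    field
      len  : Fin k → Carrier
      rule : Fin k → List (Fin k)
      init : Fin k

    word : ℕ → List (Fin k)
    word zero    = [ init ]
    word (suc n) = concatMap rule (word n)

    partialSum : List (Fin k) → ℕ → Carrier
    partialSum w m = sumL (map len (take m w))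

    -- Each word is a prefix of the limit infinite word, so the endpoints
    -- of the tiling are exactly the partial sums of prefixes of the words.
    IsEndpoint : Carrier → Set ℓ₁
    IsEndpoint x = ∃[ n ] ∃[ m ] ((m ℕ.≤ length (word n)) × (x ≈ partialSum (word n) m))

    -- Inflationary with multiplier ρ: a rule f assigning to each tile
    -- length ℓ a list of lengths with sum ρℓ such that, for every tile
    -- [y_i, y_{i+1}] (the i-th letter of some word), the interval
    -- [ρ y_i, ρ y_{i+1}] is exactly the union of consecutive tiles,
    -- starting at the endpoint ρ y_i, whose lengths in order are f ℓ.
    IsInflationary : Carrier → Set (c ⊔ ℓ₁)
    IsInflationary ρ =
      Σ (Carrier → List Carrier) λ f →
        (∀ x y → x ≈ y → Pointwise _≈_ (f x) (f y)) ×
        (∀ n (i : Fin (length (word n))) →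
          let ℓ = len (lookup (word n) i) in
          (sumL (f ℓ) ≈ (ρ * ℓ)) ×
          (∃[ n' ] ∃[ j ]
             (((j ℕ.+ length (f ℓ)) ℕ.≤ length (word n')) ×
              (partialSum (word n') j ≈ (ρ * partialSum (word n) (toℕ i))) ×
              Pointwise _≈_ (map len (take (length (f ℓ)) (drop j (word n')))) (f ℓ))))

  open Substitution public

  -- Tiling (1): R_j of length ρ^(1-j) (0-indexed: R_j has length ρ^(-j)),
  -- ρR_1 = R_1|...|R_N, ρR_j = R_{j-1}.
  rule₁ : ∀ {N} → Fin N → List (Fin N)
  rule₁ {suc n} Fin.zero    = allFin (suc n)
  rule₁ {suc n} (Fin.suc j) = [ inject₁ j ]

  T₁ : Carrier → (N : ℕ) → .(0 ℕ.< N) → Substitution N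
  T₁ ρ N 0<N = record
    { len  = λ j → pow (ρ ⁻¹) (toℕ j)
    ; rule = rule₁
    ; init = fromℕ< 0<N }

  -- Tiling (2): R̂_1 of length 1, R̂_j (2 ≤ j ≤ N) of length
  -- Σ_{i=1}^{N-j+1} ρ^(-i); ρR̂_j = R̂_1|R̂_{j+1} (j<N), ρR̂_N = R̂_1.
  -- (0-indexed: index 0 is R̂_1, index j ≥ 1 is R̂_{j+1}.)
  len₂ : Carrier → (N : ℕ) → Fin N → Carrier
  len₂ ρ N Fin.zero    = 1#
  len₂ ρ N (Fin.suc j) = sumL (map (λ i → pow (ρ ⁻¹) (suc i)) (upTo (N ∸ suc (toℕ j))))

  rule₂ : ∀ {N} → Fin N → List (Fin N)
  rule₂ {suc n} j with suc (toℕ j) <? suc n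
  ... | yes p = Fin.zero ∷ fromℕ< p ∷ []
  ... | no _  = Fin.zero ∷ []

  T₂ : Carrier → (N : ℕ) → .(0 ℕ.< N) → Substitution N
  T₂ ρ N 0<N = record
    { len  = len₂ ρ N
    ; rule = rule₂
    ; init = fromℕ< 0<N }

{-# OPTIONS --safe #-}

-- Write |u| for the total length of a word u.  Every rule of T̂ is R̂₁ or R̂₁R̂_{j+1},
-- |R̂₁| = 1, and each rule has length ρ times that of its tile (for R̂₁ this is
-- ρ = 1 + ρ⁻¹ + ⋯ + ρ^(1-N), the defining equation of ρ).  So if y is the length of a
-- prefix of a word, the letter following it (the words keep growing) is substituted by
-- a word starting with R̂₁, and ρy, ρy + 1 are prefix lengths again.  Conversely a prefix
-- of a substituted word σ w is σ of a prefix of w followed by at most R̂₁, so its length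
-- is ρy or ρy + 1 for a prefix length y of w.  By Horner's scheme the ρ-integers are
-- exactly the closure of 0 under y ↦ ρy and y ↦ ρy + 1, hence they are the endpoints
-- of T̂.  The rule of a tile of length ℓ is determined by ℓ (R̂₁ then a tile of length
-- ρℓ - 1, except ρ|R̂_N| = 1), which makes T̂ inflationary.
-- For (1), R̂₁ ↦ R₁ and R̂_j ↦ R₂⋯R_{N-j+2} (j ≥ 2) preserves lengths and intertwines
-- the two substitutions, so it maps each word of T̂ to the corresponding word of T, and
-- every endpoint of T̂ is an endpoint of T.
module Submission where

open import Defs
open import Level using (Level)
open import Data.Nat using (ℕ; zero; suc; _≤_; z≤n; s≤s; _∸_)
import Data.Nat as ℕ
open import Data.Nat.Properties using (≤-trans)
import Data.Nat.Properties as ℕ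
open import Data.Fin using (Fin; zero; suc; toℕ; inject₁; fromℕ<)
open import Data.Fin.Properties using (toℕ<n; toℕ-fromℕ<)
open import Data.Bool using (Bool; true; false; if_then_else_)
open import Data.List using (List; []; _∷_; [_]; _++_; map; foldl; concatMap; take; drop; length; lookup; upTo; allFin; tabulate)
open import Data.List.Properties
  using (++-assoc; ++-identityʳ; ++-conicalˡ; ∷-injective; length-++; length-++-≤ˡ; length-map; map-++; map-∘; take-map;
         take++drop≡id; take-all; concatMap-cong; concatMap-++; map-tabulate; tabulate-lookup; length-tabulate;
         map-applyUpTo; map-upTo; upTo-∷ʳ; foldl-++)
open import Data.List.Relation.Binary.Pointwise using (Pointwise; []; _∷_; Pointwise-length)
open import Data.Product using (∃; ∃₂; ∃-syntax; _×_; _,_)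
open import Data.Sum using (_⊎_; inj₁; inj₂)
open import Data.Empty using (⊥-elim)
open import Function using (_∘_; id)
open import Relation.Nullary using (¬_; yes; no)
open import Relation.Binary.PropositionalEquality
  using (_≡_; refl; sym; trans; cong; cong₂; subst; subst₂; module ≡-Reasoning)
open import Relation.Binary.Definitions using (tri<; tri≈; tri>)
open import Relation.Binary.Structures using (IsStrictTotalOrder)
import Relation.Binary.Reasoning.Setoid as SetoidReasoning
import Algebra.Properties.Ring as RingProperties
import Algebra.Properties.Group as GroupProperties
import Algebra.Solver.Ring.NaturalCoefficients.Default as SemiringSolver

module _ {a} {A : Set a} where

  take-length-++ : ∀ (u v : List A) → take (length u) (u ++ v) ≡ u
  take-length-++ []      v = refl
  take-length-++ (x ∷ u) v = cong (x ∷_) (take-length-++ u v)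

  drop-length-++ : ∀ (u v : List A) → drop (length u) (u ++ v) ≡ v
  drop-length-++ []      v = refl
  drop-length-++ (x ∷ u) v = drop-length-++ u v

  ++-infix : ∀ {w : List A} u v t → w ≡ u ++ v ++ t →
    (length u ℕ.+ length v ≤ length w) × (take (length u) w ≡ u) × (take (length v) (drop (length u) w) ≡ v)
  ++-infix u v t refl =
    subst₂ _≤_ (length-++ u) (cong length (++-assoc u v t)) (length-++-≤ˡ (u ++ v)) ,
    take-length-++ u (v ++ t) ,
    trans (cong (take (length v)) (drop-length-++ u (v ++ t))) (take-length-++ v t)

  take-lookup-drop : ∀ (w : List A) (i : Fin (length w)) →
    w ≡ take (toℕ i) w ++ lookup w i ∷ drop (suc (toℕ i)) w
  take-lookup-drop (x ∷ w) zero    = refl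
  take-lookup-drop (x ∷ w) (suc i) = cong (x ∷_) (take-lookup-drop w i)

  map-upTo-suc : ∀ (h : ℕ → A) m → map h (upTo (suc m)) ≡ h 0 ∷ map (h ∘ suc) (upTo m)
  map-upTo-suc h m = cong (h 0 ∷_) (trans (map-applyUpTo suc h m) (sym (map-upTo (h ∘ suc) m)))

∸≡suc∸suc : ∀ {m t} → t ℕ.< m → m ∸ t ≡ suc (m ∸ suc t)
∸≡suc∸suc = ℕ.+-∸-assoc 1

concatMap-concatMap : ∀ {a b c} {A : Set a} {B : Set b} {C : Set c} (f : B → List C) (g : A → List B) xs →
  concatMap f (concatMap g xs) ≡ concatMap (concatMap f ∘ g) xs
concatMap-concatMap f g []       = refl
concatMap-concatMap f g (x ∷ xs) =
  trans (concatMap-++ f (g x) (concatMap g xs)) (cong (concatMap f (g x) ++_) (concatMap-concatMap f g xs))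

take-suc-allFin : ∀ m n → take (suc m) (allFin (suc n)) ≡ zero ∷ map suc (take m (allFin n))
take-suc-allFin m n = cong (zero ∷_) (trans (cong (take m) (sym (map-tabulate id suc))) (take-map m (allFin n)))

map-inject₁-take-allFin : ∀ {m n} → m ≤ n → map inject₁ (take m (allFin n)) ≡ take m (allFin (suc n))
map-inject₁-take-allFin {zero}          _         = refl
map-inject₁-take-allFin {suc m} {suc n} (s≤s m≤n) = begin
  map inject₁ (take (suc m) (allFin (suc n)))        ≡⟨ cong (map inject₁) (take-suc-allFin m n) ⟩
  zero ∷ map inject₁ (map suc (take m (allFin n)))   ≡⟨ cong (zero ∷_) (trans (sym (map-∘ xs)) (map-∘ xs)) ⟩
  zero ∷ map suc (map inject₁ (take m (allFin n)))   ≡⟨ cong (λ ys → zero ∷ map suc ys) (map-inject₁-take-allFin m≤n) ⟩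
  zero ∷ map suc (take m (allFin (suc n)))           ≡⟨ sym (take-suc-allFin m (suc n)) ⟩
  take (suc m) (allFin (suc (suc n)))                ∎
  where
  open ≡-Reasoning
  xs : List (Fin n)
  xs = take m (allFin n)

map-toℕ-take-allFin : ∀ {m n} → m ≤ n → map toℕ (take m (allFin n)) ≡ upTo m
map-toℕ-take-allFin {zero}          _         = refl
map-toℕ-take-allFin {suc m} {suc n} (s≤s m≤n) = begin
  map toℕ (take (suc m) (allFin (suc n)))       ≡⟨ cong (map toℕ) (take-suc-allFin m n) ⟩
  0 ∷ map toℕ (map suc (take m (allFin n)))     ≡⟨ cong (0 ∷_) (trans (sym (map-∘ xs)) (map-∘ xs)) ⟩
  0 ∷ map suc (map toℕ (take m (allFin n)))     ≡⟨ cong (λ ys → 0 ∷ map suc ys) (map-toℕ-take-allFin m≤n) ⟩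
  0 ∷ map suc (upTo m)                          ≡⟨ cong (0 ∷_) (map-upTo suc m) ⟩
  upTo (suc m)                                  ∎
  where
  open ≡-Reasoning
  xs : List (Fin n)
  xs = take m (allFin n)

module _ {c ℓ₁ ℓ₂ : Level} (F : OrderedField c ℓ₁ ℓ₂) where

  open OrderedField F hiding (zero) renaming (refl to ≈-refl; sym to ≈-sym; trans to ≈-trans)
  open Tiling F
  open IsStrictTotalOrder isStrictTotalOrder
    using (compare; _≟_; <-respˡ-≈; <-respʳ-≈) renaming (irrefl to <-irrefl; trans to <-trans)
  open RingProperties ring using (-1*x≈-x; -‿distribʳ-*)
  open GroupProperties +-group using (⁻¹-involutive; identityʳ-unique; x∙y⁻¹≈ε⇒x≈y; x≈z//y)
  open SemiringSolver commutativeSemiring using (solve; _:=_; _:+_; _:*_)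
  module ≈-Reasoning = SetoidReasoning setoid

  x<0⇒0<-x : ∀ {x} → x < 0# → 0# < (- x)
  x<0⇒0<-x {x} x<0 = <-respʳ-≈ (+-identityˡ (- x)) (<-respˡ-≈ (-‿inverseʳ x) (+-monoˡ-< (- x) x<0))

  0<1 : 0# < 1#
  0<1 with compare 0# 1#
  ... | tri< 0<1 _ _ = 0<1
  ... | tri≈ _ 0≈1 _ = ⊥-elim (0≉1 0≈1)
  ... | tri> _ _ 1<0 = ⊥-elim (<-irrefl ≈-refl (<-trans (<-respʳ-≈ [-1][-1]≈1 (*-pos 0<-1 0<-1)) 1<0))
    where
    0<-1 : 0# < (- 1#)
    0<-1 = x<0⇒0<-x 1<0
    [-1][-1]≈1 : - 1# * - 1# ≈ 1#
    [-1][-1]≈1 = ≈-trans (-1*x≈-x (- 1#)) (⁻¹-involutive 1#)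

  ¬0<-1 : ¬ (0# < (- 1#))
  ¬0<-1 0<-1 = <-irrefl ≈-refl (<-trans 0<1 (<-respʳ-≈ (-‿inverseˡ 1#) (<-respˡ-≈ (+-identityˡ 1#) (+-monoˡ-< 1# 0<-1))))

  0<x⇒x≉0 : ∀ {x} → 0# < x → ¬ (x ≈ 0#)
  0<x⇒x≉0 0<x x≈0 = <-irrefl (≈-sym x≈0) 0<x

  0<x⇒0<x⁻¹ : ∀ {x} → 0# < x → 0# < (x ⁻¹)
  0<x⇒0<x⁻¹ {x} 0<x with compare 0# (x ⁻¹)
  ... | tri< 0<x⁻¹ _ _ = 0<x⁻¹
  ... | tri≈ _ 0≈x⁻¹ _ =
    ⊥-elim (0≉1 (≈-trans (≈-sym (≈-trans (*-congˡ (≈-sym 0≈x⁻¹)) (zeroʳ x))) (⁻¹-inverse x (0<x⇒x≉0 0<x))))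
  ... | tri> _ _ x⁻¹<0 = ⊥-elim (¬0<-1 (<-respʳ-≈ x[-x⁻¹]≈-1 (*-pos 0<x (x<0⇒0<-x x⁻¹<0))))
    where
    x[-x⁻¹]≈-1 : x * - x ⁻¹ ≈ - 1#
    x[-x⁻¹]≈-1 = ≈-trans (≈-sym (-‿distribʳ-* x (x ⁻¹))) (-‿cong (⁻¹-inverse x (0<x⇒x≉0 0<x)))

  0<+ : ∀ {x y} → 0# < x → 0# < y → 0# < (x + y)
  0<+ {x} {y} 0<x 0<y = <-trans 0<y (<-respˡ-≈ (+-identityˡ y) (+-monoˡ-< y 0<x))

  0<pow : ∀ {x} m → 0# < x → 0# < pow x m
  0<pow zero    _   = 0<1
  0<pow (suc m) 0<x = *-pos 0<x (0<pow m 0<x)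

  *-cancelˡ : ∀ {x y z} → ¬ (x ≈ 0#) → x * y ≈ x * z → y ≈ z
  *-cancelˡ {x} {y} {z} x≉0 xy≈xz = begin
    y                    ≈⟨ x⁻¹[xw]≈w y ⟨
    x ⁻¹ * (x * y)       ≈⟨ *-congˡ xy≈xz ⟩
    x ⁻¹ * (x * z)       ≈⟨ x⁻¹[xw]≈w z ⟩
    z                    ∎
    where
    open ≈-Reasoning
    x⁻¹[xw]≈w : ∀ w → x ⁻¹ * (x * w) ≈ w
    x⁻¹[xw]≈w w = begin
      x ⁻¹ * (x * w)     ≈⟨ solve 3 (λ i x w → i :* (x :* w) := (x :* i) :* w) ≈-refl (x ⁻¹) x w ⟩
      (x * x ⁻¹) * w     ≈⟨ *-congʳ (⁻¹-inverse x x≉0) ⟩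
      1# * w             ≈⟨ *-identityˡ w ⟩
      w                  ∎

  sumL-++ : ∀ xs ys → sumL (xs ++ ys) ≈ sumL xs + sumL ys
  sumL-++ []       ys = ≈-sym (+-identityˡ (sumL ys))
  sumL-++ (x ∷ xs) ys = ≈-trans (+-congˡ (sumL-++ xs ys)) (≈-sym (+-assoc x (sumL xs) (sumL ys)))

  sumL-cong : ∀ {xs ys} → Pointwise _≈_ xs ys → sumL xs ≈ sumL ys
  sumL-cong []            = ≈-refl
  sumL-cong (x≈y ∷ xs≈ys) = +-cong x≈y (sumL-cong xs≈ys)

  sumL-map-*ˡ : ∀ {a} {A : Set a} k (g : A → Carrier) xs → sumL (map (λ x → k * g x) xs) ≈ k * sumL (map g xs)
  sumL-map-*ˡ k g []       = ≈-sym (zeroʳ k)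
  sumL-map-*ˡ k g (x ∷ xs) = ≈-trans (+-congˡ (sumL-map-*ˡ k g xs)) (≈-sym (distribˡ k (g x) (sumL (map g xs))))

  bit : Bool → Carrier
  bit b = if b then 1# else 0#

  module ρIntegers (ρ : Carrier) where

    digitStep : Carrier → Bool → Carrier
    digitStep y b = ρ * y + bit b

    horner : List Bool → Carrier
    horner = foldl digitStep 0#

    expansion : List Bool → Carrier
    expansion []       = 0#
    expansion (b ∷ bs) = (if b then pow ρ (length bs) else 0#) + expansion bs

    ρ*-+-digitStep : ∀ x y b → ρ * x + digitStep y b ≈ digitStep (x + y) b
    ρ*-+-digitStep x y b =
      solve 4 (λ ρ x y b → ρ :* x :+ (ρ :* y :+ b) := ρ :* (x :+ y) :+ b) ≈-refl ρ x y (bit b)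

    *-bit : ∀ x b → x * bit b ≈ (if b then x else 0#)
    *-bit x true  = *-identityʳ x
    *-bit x false = zeroʳ x

    foldl-digitStep : ∀ y bs → foldl digitStep y bs ≈ pow ρ (length bs) * y + expansion bs
    foldl-digitStep y []       = ≈-sym (≈-trans (+-identityʳ (1# * y)) (*-identityˡ y))
    foldl-digitStep y (b ∷ bs) = begin
      foldl digitStep (ρ * y + bit b) bs  ≈⟨ foldl-digitStep (ρ * y + bit b) bs ⟩
      X * (ρ * y + bit b) + expansion bs  ≈⟨ solve 5 (λ X ρ y b e → X :* (ρ :* y :+ b) :+ e := (ρ :* X) :* y :+ (X :* b :+ e))
                                                     ≈-refl X ρ y (bit b) (expansion bs) ⟩
      (ρ * X) * y + (X * bit b + expansion bs)               ≈⟨ +-congˡ (+-congʳ (*-bit X b)) ⟩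
      (ρ * X) * y + ((if b then X else 0#) + expansion bs)   ∎
      where
      open ≈-Reasoning
      X : Carrier
      X = pow ρ (length bs)

    horner≈expansion : ∀ bs → horner bs ≈ expansion bs
    horner≈expansion bs = ≈-trans (foldl-digitStep 0# bs) (≈-trans (+-congʳ (zeroʳ _)) (+-identityˡ _))

    horner-∷ʳ : ∀ bs b → horner (bs ++ [ b ]) ≡ digitStep (horner bs) b
    horner-∷ʳ bs b = foldl-++ digitStep 0# bs [ b ]

    sum-digits≡expansion : ∀ n (cs : Fin (suc n) → Bool) →
      sumL (map (λ (i : Fin (suc n)) → if cs i then pow ρ (n ∸ toℕ i) else 0#) (allFin (suc n))) ≡ expansion (tabulate cs)
    sum-digits≡expansion n cs =
      trans (cong sumL (map-tabulate id (λ i → if cs i then pow ρ (n ∸ toℕ i) else 0#))) (sum-tabulate n cs)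
      where
      sum-tabulate : ∀ n (cs : Fin (suc n) → Bool) →
        sumL (tabulate (λ i → if cs i then pow ρ (n ∸ toℕ i) else 0#)) ≡ expansion (tabulate cs)
      sum-tabulate zero    cs = refl
      sum-tabulate (suc n) cs = cong₂ _+_
        (cong (λ m → if cs zero then pow ρ m else 0#) (sym (length-tabulate (cs ∘ suc))))
        (sum-tabulate n (cs ∘ suc))

    ρInteger⇒horner : ∀ {x} → IsρInteger ρ x → ∃ λ bs → x ≈ horner bs
    ρInteger⇒horner (n , cs , x≈) =
      tabulate cs , ≈-trans x≈ (≈-trans (reflexive (sum-digits≡expansion n cs)) (≈-sym (horner≈expansion (tabulate cs))))

    horner-ρInteger : ∀ bs → IsρInteger ρ (horner bs)
    horner-ρInteger []       = 0 , (λ _ → false) , ≈-sym (+-identityʳ 0#)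
    horner-ρInteger (b ∷ bs) = length bs , lookup (b ∷ bs) , ≈-trans (horner≈expansion (b ∷ bs)) (reflexive (sym (begin
      sumL (map _ (allFin (suc (length bs))))   ≡⟨ sum-digits≡expansion (length bs) (lookup (b ∷ bs)) ⟩
      expansion (tabulate (lookup (b ∷ bs)))    ≡⟨ cong expansion (tabulate-lookup (b ∷ bs)) ⟩
      expansion (b ∷ bs)                        ∎)))
      where open ≡-Reasoning

  module _ {k} (T : Substitution k) where

    lengthSum : List (Fin k) → Carrier
    lengthSum u = sumL (map (len T) u)

    LengthsScaleBy : Carrier → Set ℓ₁
    LengthsScaleBy ρ = ∀ a → lengthSum (rule T a) ≈ ρ * len T a

    lengthSum-++ : ∀ u v → lengthSum (u ++ v) ≈ lengthSum u + lengthSum v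
    lengthSum-++ u v = ≈-trans (reflexive (cong sumL (map-++ (len T) u v))) (sumL-++ (map (len T) u) (map (len T) v))

    lengthSum-concatMap : ∀ {a} {A : Set a} (σ : A → List (Fin k)) (g : A → Carrier) →
      (∀ x → lengthSum (σ x) ≈ g x) → ∀ xs → lengthSum (concatMap σ xs) ≈ sumL (map g xs)
    lengthSum-concatMap σ g σ≈g []       = ≈-refl
    lengthSum-concatMap σ g σ≈g (x ∷ xs) =
      ≈-trans (lengthSum-++ (σ x) (concatMap σ xs)) (+-cong (σ≈g x) (lengthSum-concatMap σ g σ≈g xs))

    lengthSum-substitute : ∀ {ρ} → LengthsScaleBy ρ → ∀ u → lengthSum (concatMap (rule T) u) ≈ ρ * lengthSum u
    lengthSum-substitute {ρ} scales u =
      ≈-trans (lengthSum-concatMap (rule T) (λ a → ρ * len T a) scales u) (sumL-map-*ˡ ρ (len T) u)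

    IsEndpoint-resp : ∀ {x y} → x ≈ y → IsEndpoint T x → IsEndpoint T y
    IsEndpoint-resp x≈y (n , m , m≤ , x≈) = n , m , m≤ , ≈-trans (≈-sym x≈y) x≈

    split⇒endpoint : ∀ n u v → word T n ≡ u ++ v → IsEndpoint T (lengthSum u)
    split⇒endpoint n u v w≡ =
      let (bound , _ , prefix) = ++-infix [] u v w≡ in n , length u , bound , reflexive (cong lengthSum (sym prefix))

    endpoint⇒split : ∀ {x} → IsEndpoint T x → ∃[ n ] ∃[ u ] ∃[ v ] (word T n ≡ u ++ v × x ≈ lengthSum u)
    endpoint⇒split (n , m , _ , x≈) = n , take m (word T n) , drop m (word T n) , sym (take++drop≡id m (word T n)) , x≈

    word-suc-at : ∀ n (i : Fin (length (word T n))) → let w = word T n; σ* = concatMap (rule T) in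
      word T (suc n) ≡ σ* (take (toℕ i) w) ++ rule T (lookup w i) ++ σ* (drop (suc (toℕ i)) w)
    word-suc-at n i =
      trans (cong (concatMap (rule T)) (take-lookup-drop (word T n) i)) (concatMap-++ (rule T) (take (toℕ i) (word T n)) _)

    inflationary-by-length : ∀ {ρ} (f : Carrier → List Carrier) → (∀ x y → x ≈ y → Pointwise _≈_ (f x) (f y)) →
      LengthsScaleBy ρ → (∀ a → Pointwise _≈_ (map (len T) (rule T a)) (f (len T a))) → IsInflationary T ρ
    inflationary-by-length {ρ} f f-cong scales tiles = f , f-cong , λ n i →
      let a = lookup (word T n) i
          u = take (toℕ i) (word T n)
          j = length (concatMap (rule T) u)
          (bound , prefix , block) = ++-infix (concatMap (rule T) u) (rule T a) _ (word-suc-at n i)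
          size : length (rule T a) ≡ length (f (len T a))
          size = trans (sym (length-map (len T) (rule T a))) (Pointwise-length (tiles a))
      in ≈-trans (≈-sym (sumL-cong (tiles a))) (scales a) ,
         suc n , j ,
         subst (λ s → j ℕ.+ s ≤ length (word T (suc n))) size bound ,
         ≈-trans (reflexive (cong lengthSum prefix)) (lengthSum-substitute scales u) ,
         subst (λ s → Pointwise _≈_ (map (len T) (take s (drop j (word T (suc n))))) (f (len T a)))
               size (subst (λ v → Pointwise _≈_ (map (len T) v) (f (len T a))) (sym block) (tiles a))

  module _ {k l} (S : Substitution k) (T : Substitution l) (φ : Fin k → List (Fin l))
           (φ-init : φ (init S) ≡ [ init T ])
           (φ-rule : ∀ a → concatMap (rule T) (φ a) ≡ concatMap φ (rule S a)) where

    word-φ : ∀ n → word T n ≡ concatMap φ (word S n)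
    word-φ zero    = trans (sym (++-identityʳ [ init T ])) (cong (_++ []) (sym φ-init))
    word-φ (suc n) = begin
      concatMap (rule T) (word T n)                    ≡⟨ cong (concatMap (rule T)) (word-φ n) ⟩
      concatMap (rule T) (concatMap φ (word S n))      ≡⟨ concatMap-concatMap (rule T) φ (word S n) ⟩
      concatMap (concatMap (rule T) ∘ φ) (word S n)    ≡⟨ concatMap-cong φ-rule (word S n) ⟩
      concatMap (concatMap φ ∘ rule S) (word S n)      ≡⟨ sym (concatMap-concatMap φ (rule S) (word S n)) ⟩
      concatMap φ (concatMap (rule S) (word S n))      ∎
      where open ≡-Reasoning

    endpoint-φ : (∀ a → lengthSum T (φ a) ≈ len S a) → ∀ x → IsEndpoint S x → IsEndpoint T x
    endpoint-φ lengths x x∈S =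
      let (n , u , v , w≡ , x≈) = endpoint⇒split S x∈S
      in IsEndpoint-resp T (≈-trans (lengthSum-concatMap T φ (len S) lengths u) (≈-sym x≈))
           (split⇒endpoint T n (concatMap φ u) (concatMap φ v)
             (trans (word-φ n) (trans (cong (concatMap φ) w≡) (concatMap-++ φ u v))))

  module UnitLedSubstitution {k} (T : Substitution k) (ρ : Carrier) (scales : LengthsScaleBy T ρ)
    (len-init : len T (init T) ≈ 1#)
    (rule-shape : ∀ a → rule T a ≡ [ init T ] ⊎ ∃ λ b → rule T a ≡ init T ∷ b ∷ [])
    (init-rule : ∃ λ b → rule T (init T) ≡ init T ∷ b ∷ []) where

    open ρIntegers ρ

    private
      ι : Fin k
      ι = init T

      σ* : List (Fin k) → List (Fin k)
      σ* = concatMap (rule T)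

    rule-head : ∀ a → ∃ λ t → rule T a ≡ ι ∷ t
    rule-head a with rule-shape a
    ... | inj₁ ra       = [] , ra
    ... | inj₂ (b , ra) = [ b ] , ra

    word-grows : ∀ n → ∃₂ λ a t → word T (suc n) ≡ word T n ++ a ∷ t
    word-grows zero    = let (b , ra) = init-rule in b , [] , trans (++-identityʳ (rule T ι)) ra
    word-grows (suc n) =
      let (a , t , grows) = word-grows n
          (s , ra) = rule-head a
      in ι , s ++ σ* t , (begin
        σ* (word T (suc n))                 ≡⟨ cong σ* grows ⟩
        σ* (word T n ++ a ∷ t)              ≡⟨ concatMap-++ (rule T) (word T n) (a ∷ t) ⟩
        word T (suc n) ++ rule T a ++ σ* t  ≡⟨ cong (λ r → word T (suc n) ++ r ++ σ* t) ra ⟩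
        word T (suc n) ++ ι ∷ s ++ σ* t     ∎)
      where open ≡-Reasoning

    split-grows : ∀ n u v → word T n ≡ u ++ v → ∃₂ λ a t → word T (suc n) ≡ u ++ a ∷ t
    split-grows n u v w≡ =
      let (a , t , grows) = word-grows n
          (a′ , t′ , v≡) = cons-form v a t
      in a′ , t′ , trans grows (trans (cong (_++ a ∷ t) w≡) (trans (++-assoc u v (a ∷ t)) (cong (u ++_) v≡)))
      where
      cons-form : ∀ v a t → ∃₂ λ b s → v ++ a ∷ t ≡ b ∷ s
      cons-form []      a t = a , t , refl
      cons-form (x ∷ v) a t = x , v ++ a ∷ t , refl

    unit≈digitStep : lengthSum T [ ι ] ≈ digitStep 0# true
    unit≈digitStep = ≈-trans (+-identityʳ (len T ι)) (≈-trans len-init (≈-sym (≈-trans (+-congʳ (zeroʳ ρ)) (+-identityˡ 1#))))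

    unit-endpoints : ∀ n u r → word T n ≡ u ++ ι ∷ r → ∀ b → IsEndpoint T (lengthSum T u + bit b)
    unit-endpoints n u r w≡ false = IsEndpoint-resp T (≈-sym (+-identityʳ _)) (split⇒endpoint T n u (ι ∷ r) w≡)
    unit-endpoints n u r w≡ true  =
      IsEndpoint-resp T (≈-trans (lengthSum-++ T u [ ι ]) (+-congˡ (≈-trans (+-identityʳ (len T ι)) len-init)))
        (split⇒endpoint T n (u ++ [ ι ]) r (trans w≡ (sym (++-assoc u [ ι ] r))))

    endpoint-digitStep : ∀ {y} → IsEndpoint T y → ∀ b → IsEndpoint T (digitStep y b)
    endpoint-digitStep y∈ b =
      let (n , u , v , w≡ , y≈) = endpoint⇒split T y∈
          (a , t , w′≡) = split-grows n u v w≡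
          (s , ra) = rule-head a
          w″≡ : word T (suc (suc n)) ≡ σ* u ++ ι ∷ s ++ σ* t
          w″≡ = trans (cong σ* w′≡) (trans (concatMap-++ (rule T) u (a ∷ t)) (cong (λ r → σ* u ++ r ++ σ* t) ra))
      in IsEndpoint-resp T (+-congʳ (≈-trans (lengthSum-substitute T scales u) (*-congˡ (≈-sym y≈))))
           (unit-endpoints (suc (suc n)) (σ* u) (s ++ σ* t) w″≡ b)

    endpoint-foldl : ∀ {y} bs → IsEndpoint T y → IsEndpoint T (foldl digitStep y bs)
    endpoint-foldl []       y∈ = y∈
    endpoint-foldl (b ∷ bs) y∈ = endpoint-foldl bs (endpoint-digitStep y∈ b)

    ρInteger⇒endpoint : ∀ x → IsρInteger ρ x → IsEndpoint T x
    ρInteger⇒endpoint x x∈ =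
      let (bs , x≈) = ρInteger⇒horner x∈
      in IsEndpoint-resp T (≈-sym x≈) (endpoint-foldl bs (0 , 0 , z≤n , ≈-refl))

    PrefixPreimage : List (Fin k) → List (Fin k) → Set ℓ₁
    PrefixPreimage w u′ = ∃[ u ] ∃[ v ] ∃[ b ] (w ≡ u ++ v × lengthSum T u′ ≈ digitStep (lengthSum T u) b)

    preimage-∷ : ∀ {a w p u″} → rule T a ≡ p → PrefixPreimage w u″ → PrefixPreimage (a ∷ w) (p ++ u″)
    preimage-∷ {a} {w} {p} {u″} ra (u , v , b , w≡ , u″≈) = a ∷ u , v , b , cong (a ∷_) w≡ , (begin
      lengthSum T (p ++ u″)                        ≈⟨ lengthSum-++ T p u″ ⟩
      lengthSum T p + lengthSum T u″               ≈⟨ +-cong (≈-trans (reflexive (cong (lengthSum T) (sym ra))) (scales a)) u″≈ ⟩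
      ρ * len T a + digitStep (lengthSum T u) b    ≈⟨ ρ*-+-digitStep (len T a) (lengthSum T u) b ⟩
      digitStep (lengthSum T (a ∷ u)) b            ∎)
      where open ≈-Reasoning

    desubstitute : ∀ w u′ v′ → σ* w ≡ u′ ++ v′ → PrefixPreimage w u′
    desubstitute w       []           v′ _   = [] , w , false , refl , ≈-sym (≈-trans (+-identityʳ (ρ * 0#)) (zeroʳ ρ))
    desubstitute []      (x ∷ u′)     v′ ()
    desubstitute (a ∷ w) (x ∷ [])     v′ σ*≡ with rule-head a
    ... | s , ra with ∷-injective (trans (cong (_++ σ* w) (sym ra)) σ*≡)
    ...   | refl , _ = [] , a ∷ w , true , refl , unit≈digitStep
    desubstitute (a ∷ w) (x ∷ y ∷ u″) v′ σ*≡ with rule-shape a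
    desubstitute (a ∷ w) (x ∷ y ∷ u″) v′ σ*≡ | inj₁ ra with ∷-injective (trans (cong (_++ σ* w) (sym ra)) σ*≡)
    ...   | refl , σ*w≡ = preimage-∷ {u″ = y ∷ u″} ra (desubstitute w (y ∷ u″) v′ σ*w≡)
    desubstitute (a ∷ w) (x ∷ y ∷ u″) v′ σ*≡ | inj₂ (b , ra) with ∷-injective (trans (cong (_++ σ* w) (sym ra)) σ*≡)
    ...   | refl , b∷σ*w≡ with ∷-injective b∷σ*w≡
    ...     | refl , σ*w≡ = preimage-∷ {u″ = u″} ra (desubstitute w u″ v′ σ*w≡)

    split⇒horner : ∀ n u v → word T n ≡ u ++ v → ∃ λ bs → lengthSum T u ≈ horner bs
    split⇒horner zero    []      v _  = [] , ≈-refl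
    split⇒horner zero    (x ∷ u) v w≡ with ∷-injective w≡
    ... | refl , []≡ rewrite ++-conicalˡ u v (sym []≡) = [ true ] , unit≈digitStep
    split⇒horner (suc n) u       v w≡ =
      let (u₀ , v₀ , b , w≡₀ , u≈) = desubstitute (word T n) u v w≡
          (bs , u₀≈) = split⇒horner n u₀ v₀ w≡₀
      in bs ++ [ b ] , ≈-trans u≈ (≈-trans (+-congʳ (*-congˡ u₀≈)) (reflexive (sym (horner-∷ʳ bs b))))

    endpoint⇒ρInteger : ∀ x → IsEndpoint T x → IsρInteger ρ x
    endpoint⇒ρInteger x x∈ =
      let (n , u , v , w≡ , x≈) = endpoint⇒split T x∈
          (bs , u≈) = split⇒horner n u v w≡
          (m , cs , h≈) = horner-ρInteger bs
      in m , cs , ≈-trans x≈ (≈-trans u≈ h≈)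

  module GeometricSums (ρ : Carrier) (0<ρ : 0# < ρ) where

    invPowSum : ℕ → Carrier
    invPowSum m = sumL (map (λ i → pow (ρ ⁻¹) (suc i)) (upTo m))

    powSum : ℕ → Carrier
    powSum m = sumL (map (pow ρ) (upTo m))

    invPowSum-suc : ∀ m → invPowSum (suc m) ≈ ρ ⁻¹ * (1# + invPowSum m)
    invPowSum-suc m = begin
      invPowSum (suc m)                                          ≡⟨ cong sumL (map-upTo-suc (λ i → pow r (suc i)) m) ⟩
      r * 1# + sumL (map (λ i → r * pow r (suc i)) (upTo m))     ≈⟨ +-congˡ (sumL-map-*ˡ r (λ i → pow r (suc i)) (upTo m)) ⟩
      r * 1# + r * invPowSum m                                   ≈⟨ distribˡ r 1# (invPowSum m) ⟨
      r * (1# + invPowSum m)                                     ∎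
      where
      open ≈-Reasoning
      r : Carrier
      r = ρ ⁻¹

    ρ*invPowSum-suc : ∀ m → ρ * invPowSum (suc m) ≈ 1# + invPowSum m
    ρ*invPowSum-suc m = begin
      ρ * invPowSum (suc m)              ≈⟨ *-congˡ (invPowSum-suc m) ⟩
      ρ * (ρ ⁻¹ * (1# + invPowSum m))    ≈⟨ *-assoc ρ (ρ ⁻¹) _ ⟨
      (ρ * ρ ⁻¹) * (1# + invPowSum m)    ≈⟨ *-congʳ (⁻¹-inverse ρ (0<x⇒x≉0 0<ρ)) ⟩
      1# * (1# + invPowSum m)            ≈⟨ *-identityˡ _ ⟩
      1# + invPowSum m                   ∎
      where open ≈-Reasoning

    0<invPowSum-suc : ∀ m → 0# < invPowSum (suc m)
    0<invPowSum-suc zero    =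
      <-respʳ-≈ (≈-sym (≈-trans (invPowSum-suc 0) (≈-trans (*-congˡ (+-identityʳ 1#)) (*-identityʳ _)))) (0<x⇒0<x⁻¹ 0<ρ)
    0<invPowSum-suc (suc m) =
      <-respʳ-≈ (≈-sym (invPowSum-suc (suc m))) (*-pos (0<x⇒0<x⁻¹ 0<ρ) (0<+ 0<1 (0<invPowSum-suc m)))

    powSum-suc : ∀ m → powSum (suc m) ≈ powSum m + pow ρ m
    powSum-suc m = begin
      powSum (suc m)                                     ≡⟨ cong (sumL ∘ map (pow ρ)) (sym (upTo-∷ʳ m)) ⟩
      sumL (map (pow ρ) (upTo m ++ [ m ]))               ≡⟨ cong sumL (map-++ (pow ρ) (upTo m) [ m ]) ⟩
      sumL (map (pow ρ) (upTo m) ++ [ pow ρ m ])         ≈⟨ sumL-++ (map (pow ρ) (upTo m)) [ pow ρ m ] ⟩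
      powSum m + (pow ρ m + 0#)                          ≈⟨ +-congˡ (+-identityʳ (pow ρ m)) ⟩
      powSum m + pow ρ m                                 ∎
      where open ≈-Reasoning

    pow*invPowSum : ∀ m → pow ρ m * invPowSum m ≈ powSum m
    pow*invPowSum zero    = zeroʳ 1#
    pow*invPowSum (suc m) = begin
      (ρ * X) * invPowSum (suc m)       ≈⟨ solve 3 (λ ρ X G → (ρ :* X) :* G := X :* (ρ :* G)) ≈-refl ρ X (invPowSum (suc m)) ⟩
      X * (ρ * invPowSum (suc m))       ≈⟨ *-congˡ (ρ*invPowSum-suc m) ⟩
      X * (1# + invPowSum m)            ≈⟨ distribˡ X 1# (invPowSum m) ⟩
      X * 1# + X * invPowSum m          ≈⟨ +-cong (*-identityʳ X) (pow*invPowSum m) ⟩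
      X + powSum m                      ≈⟨ +-comm X (powSum m) ⟩
      powSum m + X                      ≈⟨ powSum-suc m ⟨
      powSum (suc m)                    ∎
      where
      open ≈-Reasoning
      X : Carrier
      X = pow ρ m

    invPowSum-root : ∀ N → charPoly N ρ ≈ 0# → invPowSum N ≈ 1#
    invPowSum-root N root = *-cancelˡ (0<x⇒x≉0 (0<pow N 0<ρ)) (begin
      pow ρ N * invPowSum N    ≈⟨ pow*invPowSum N ⟩
      powSum N                 ≈⟨ x∙y⁻¹≈ε⇒x≈y (pow ρ N) (powSum N) root ⟨
      pow ρ N                  ≈⟨ *-identityʳ (pow ρ N) ⟨
      pow ρ N * 1#             ∎)
      where open ≈-Reasoning

  module NBonacci (n : ℕ) (ρ : Carrier) (0<ρ : 0# < ρ) (root : charPoly (suc (suc n)) ρ ≈ 0#) where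

    open GeometricSums ρ 0<ρ

    K N : ℕ
    K = suc n
    N = suc K

    T̂ T : Substitution N
    T̂ = T₂ ρ N (s≤s z≤n)
    T = T₁ ρ N (s≤s z≤n)

    len̂ : Fin N → Carrier
    len̂ = len₂ ρ N

    data Rule₂Shape (a : Fin N) : List (Fin N) → Set where
      final : N ∸ suc (toℕ a) ≡ 0 → Rule₂Shape a [ zero ]
      inner : ∀ b → toℕ b ≡ suc (toℕ a) → Rule₂Shape a (zero ∷ b ∷ [])

    rule₂-shape : ∀ a → Rule₂Shape a (rule₂ a)
    rule₂-shape a with suc (toℕ a) ℕ.<? N
    ... | yes a+1<N = inner (fromℕ< a+1<N) (toℕ-fromℕ< a+1<N)
    ... | no  a+1≮N = final (ℕ.m≤n⇒m∸n≡0 (ℕ.≮⇒≥ a+1≮N))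

    len̂≈invPowSum : ∀ a → len̂ a ≈ invPowSum (N ∸ toℕ a)
    len̂≈invPowSum zero    = ≈-sym (invPowSum-root N root)
    len̂≈invPowSum (suc j) = ≈-refl

    0<len̂ : ∀ a → 0# < len̂ a
    0<len̂ zero    = 0<1
    0<len̂ (suc j) = subst (λ m → 0# < invPowSum m) (sym (∸≡suc∸suc (toℕ<n j))) (0<invPowSum-suc (K ∸ suc (toℕ j)))

    ρ*len̂ : ∀ a → ρ * len̂ a ≈ 1# + invPowSum (N ∸ suc (toℕ a))
    ρ*len̂ a = begin
      ρ * len̂ a                             ≈⟨ *-congˡ (len̂≈invPowSum a) ⟩
      ρ * invPowSum (N ∸ toℕ a)             ≡⟨ cong (λ m → ρ * invPowSum m) (∸≡suc∸suc (toℕ<n a)) ⟩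
      ρ * invPowSum (suc (N ∸ suc (toℕ a))) ≈⟨ ρ*invPowSum-suc (N ∸ suc (toℕ a)) ⟩
      1# + invPowSum (N ∸ suc (toℕ a))      ∎
      where open ≈-Reasoning

    ρ*len̂-final : ∀ {a} → N ∸ suc (toℕ a) ≡ 0 → ρ * len̂ a ≈ 1#
    ρ*len̂-final {a} last = ≈-trans (ρ*len̂ a) (≈-trans (reflexive (cong (λ m → 1# + invPowSum m) last)) (+-identityʳ 1#))

    ρ*len̂-inner : ∀ {a b} → toℕ b ≡ suc (toℕ a) → ρ * len̂ a ≈ 1# + len̂ b
    ρ*len̂-inner {a} {b} b≡ =
      ≈-trans (ρ*len̂ a) (+-congˡ (≈-sym (≈-trans (len̂≈invPowSum b) (reflexive (cong (λ t → invPowSum (N ∸ t)) b≡)))))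

    scales₂ : LengthsScaleBy T̂ ρ
    scales₂ a = scales-shape (rule₂-shape a)
      where
      scales-shape : ∀ {a w} → Rule₂Shape a w → lengthSum T̂ w ≈ ρ * len̂ a
      scales-shape {a} (final last) = ≈-trans (+-identityʳ 1#) (≈-sym (ρ*len̂-final {a} last))
      scales-shape (inner b b≡) = ≈-trans (+-congˡ (+-identityʳ (len̂ b))) (≈-sym (ρ*len̂-inner b≡))

    rule₂-unitLed : ∀ a → rule₂ a ≡ [ zero ] ⊎ ∃ λ b → rule₂ a ≡ zero ∷ b ∷ []
    rule₂-unitLed a = unitLed-shape (rule₂-shape a)
      where
      unitLed-shape : ∀ {a w} → Rule₂Shape a w → w ≡ [ zero ] ⊎ ∃ λ b → w ≡ zero ∷ b ∷ []
      unitLed-shape (final _)   = inj₁ refl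
      unitLed-shape (inner b _) = inj₂ (b , refl)

    open UnitLedSubstitution T̂ ρ scales₂ ≈-refl rule₂-unitLed (suc zero , refl) public
      using (ρInteger⇒endpoint; endpoint⇒ρInteger)

    inflationRule : Carrier → List Carrier
    inflationRule x with ρ * x ≟ 1#
    ... | yes _ = [ 1# ]
    ... | no  _ = 1# ∷ ρ * x - 1# ∷ []

    inflationRule-cong : ∀ x y → x ≈ y → Pointwise _≈_ (inflationRule x) (inflationRule y)
    inflationRule-cong x y x≈y with ρ * x ≟ 1# | ρ * y ≟ 1#
    ... | yes _    | yes _    = ≈-refl ∷ []
    ... | no  _    | no  _    = ≈-refl ∷ +-congʳ (*-congˡ x≈y) ∷ []
    ... | yes ρx≈1 | no  ρy≉1 = ⊥-elim (ρy≉1 (≈-trans (*-congˡ (≈-sym x≈y)) ρx≈1))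
    ... | no  ρx≉1 | yes ρy≈1 = ⊥-elim (ρx≉1 (≈-trans (*-congˡ x≈y) ρy≈1))

    inflationRule-tiles : ∀ a → Pointwise _≈_ (map len̂ (rule₂ a)) (inflationRule (len̂ a))
    inflationRule-tiles a = tiles-shape (rule₂-shape a)
      where
      tiles-shape : ∀ {a w} → Rule₂Shape a w → Pointwise _≈_ (map len̂ w) (inflationRule (len̂ a))
      tiles-shape {a} _ with ρ * len̂ a ≟ 1#
      tiles-shape (final last) | yes _    = ≈-refl ∷ []
      tiles-shape {a} (final last) | no ρℓ≉1  = ⊥-elim (ρℓ≉1 (ρ*len̂-final {a} last))
      tiles-shape (inner b b≡) | yes ρℓ≈1 =
        ⊥-elim (0<x⇒x≉0 (0<len̂ b) (identityʳ-unique 1# (len̂ b) (≈-trans (≈-sym (ρ*len̂-inner b≡)) ρℓ≈1)))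
      tiles-shape {a} (inner b b≡) | no _ =
        ≈-refl ∷ x≈z//y (len̂ b) 1# (ρ * len̂ a) (≈-trans (+-comm (len̂ b) 1#) (≈-sym (ρ*len̂-inner b≡))) ∷ []

    inflationary : IsInflationary T̂ ρ
    inflationary = inflationary-by-length T̂ inflationRule inflationRule-cong scales₂ inflationRule-tiles

    refine : Fin N → List (Fin N)
    refine zero    = [ zero ]
    refine (suc j) = map suc (take (K ∸ toℕ j) (allFin K))

    rule₁-refine-suc : ∀ j → concatMap rule₁ (refine (suc j)) ≡ take (K ∸ toℕ j) (allFin N)
    rule₁-refine-suc j =
      trans (rule₁-map-suc (take (K ∸ toℕ j) (allFin K))) (map-inject₁-take-allFin (ℕ.m∸n≤m K (toℕ j)))
      where
      rule₁-map-suc : ∀ (xs : List (Fin K)) → concatMap rule₁ (map suc xs) ≡ map inject₁ xs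
      rule₁-map-suc []       = refl
      rule₁-map-suc (x ∷ xs) = cong (inject₁ x ∷_) (rule₁-map-suc xs)

    refine-rule : ∀ a → concatMap rule₁ (refine a) ≡ concatMap refine (rule₂ a)
    refine-rule zero = begin
      allFin N ++ []                                ≡⟨ ++-identityʳ (allFin N) ⟩
      allFin N                                      ≡⟨ take-all N (allFin N) (ℕ.≤-reflexive (length-tabulate id)) ⟨
      take N (allFin N)                             ≡⟨ take-suc-allFin K K ⟩
      zero ∷ map suc (take K (allFin K))            ≡⟨ cong (zero ∷_) (++-identityʳ _) ⟨
      zero ∷ (map suc (take K (allFin K)) ++ [])    ∎
      where open ≡-Reasoning
    refine-rule (suc j) = refine-shape (rule₂-shape (suc j))
      where
      open ≡-Reasoning
      refine-shape : ∀ {w} → Rule₂Shape (suc j) w → concatMap rule₁ (refine (suc j)) ≡ concatMap refine w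
      refine-shape (final last) = begin
        concatMap rule₁ (refine (suc j))              ≡⟨ rule₁-refine-suc j ⟩
        take (K ∸ toℕ j) (allFin N)                   ≡⟨ cong (λ m → take m (allFin N)) (∸≡suc∸suc (toℕ<n j)) ⟩
        take (suc (K ∸ suc (toℕ j))) (allFin N)       ≡⟨ cong (λ m → take (suc m) (allFin N)) last ⟩
        [ zero ]                                      ∎
      refine-shape (inner (suc j′) j′≡) = begin
        concatMap rule₁ (refine (suc j))              ≡⟨ rule₁-refine-suc j ⟩
        take (K ∸ toℕ j) (allFin N)                   ≡⟨ cong (λ m → take m (allFin N)) (∸≡suc∸suc (toℕ<n j)) ⟩
        take (suc (K ∸ suc (toℕ j))) (allFin N)       ≡⟨ take-suc-allFin (K ∸ suc (toℕ j)) K ⟩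
        zero ∷ map suc (take (K ∸ suc (toℕ j)) (allFin K))
          ≡⟨ cong (λ t → zero ∷ map suc (take (K ∸ t) (allFin K))) (ℕ.suc-injective j′≡) ⟨
        zero ∷ refine (suc j′)                        ≡⟨ cong (zero ∷_) (++-identityʳ _) ⟨
        concatMap refine (zero ∷ suc j′ ∷ [])         ∎

    refine-length : ∀ a → lengthSum T (refine a) ≈ len̂ a
    refine-length zero    = +-identityʳ 1#
    refine-length (suc j) = reflexive (cong sumL (begin
      map (len T) (map suc xs)                       ≡⟨ map-∘ xs ⟨
      map (λ t → pow (ρ ⁻¹) (suc (toℕ t))) xs        ≡⟨ map-∘ xs ⟩
      map (λ i → pow (ρ ⁻¹) (suc i)) (map toℕ xs)
        ≡⟨ cong (map (λ i → pow (ρ ⁻¹) (suc i))) (map-toℕ-take-allFin (ℕ.m∸n≤m K (toℕ j))) ⟩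
      map (λ i → pow (ρ ⁻¹) (suc i)) (upTo (K ∸ toℕ j)) ∎))
      where
      open ≡-Reasoning
      xs : List (Fin K)
      xs = take (K ∸ toℕ j) (allFin K)

    endpoint-refine : ∀ x → IsEndpoint T̂ x → IsEndpoint T x
    endpoint-refine = endpoint-φ T̂ T refine refl refine-rule refine-length

theorem4p10 : ∀ {c ℓ₁ ℓ₂ : Level} (F : OrderedField c ℓ₁ ℓ₂) →
    let open OrderedField F
        open Tiling F
    in (N : ℕ) (N≥3 : 3 ≤ N) (ρ : Carrier) → 0# < ρ → charPoly N ρ ≈ 0# →
       (∀ x → IsρInteger ρ x → IsEndpoint (T₁ ρ N (≤-trans (s≤s z≤n) N≥3)) x) ×
       (IsInflationary (T₂ ρ N (≤-trans (s≤s z≤n) N≥3)) ρ ×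
        (∀ x → IsEndpoint (T₂ ρ N (≤-trans (s≤s z≤n) N≥3)) x → IsρInteger ρ x) ×
        (∀ x → IsρInteger ρ x → IsEndpoint (T₂ ρ N (≤-trans (s≤s z≤n) N≥3)) x))
theorem4p10 F .(suc (suc (suc k))) (s≤s (s≤s (s≤s (z≤n {k})))) ρ 0<ρ root =
  (λ x → endpoint-refine x ∘ ρInteger⇒endpoint x) , inflationary , endpoint⇒ρInteger , ρInteger⇒endpoint
  where open NBonacci F (suc k) ρ 0<ρ root
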